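{- Let $\Delta\ge1$ and $r\ge3$ be integers. If $G$ is an $\mathcal{F}^{(2)}(n,(r-1)\Delta)$-universal graph, then $\mathcal{K}_r(G)$ is an $\mathcal{F}^{(r)}(n,\Delta)$-universal hypergraph. In particular, $\mathcal{K}_r(G)$ has at most $e(G)\,\Delta(G)^{r-2}$ edges.
   Context: $\mathcal{F}^{(r)}(n,\Delta)$ is the family of $r$-uniform hypergraphs on $n$ vertices with maximum degree at most $\Delta$ ($r=2$: graphs); a (hyper)graph is $\mathcal{F}$-universal if it contains a copy of every member of $\mathcal{F}$. For a graph $G$, $\mathcal{K}_r(G)$ is the $r$-uniform hypergraph on $V(G)$ whose edges are the vertex sets of the copies of $K_r$ (complete graphs on $r$ vertices) in $G$. $\Delta(G)$ is the maximum degree of $G$. -}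

module Defs where

open import Data.Nat using (ℕ; zero; suc; _≤_; _<_; _⊔_; _*_; _^_; _∸_; _≡ᵇ_)
open import Data.Bool using (Bool; true; false; _∧_; _∨_; if_then_else_)
open import Data.Fin using (Fin; toℕ; _≟_)
open import Data.Fin.Subset using (Subset; ∣_∣; inside; outside)
open import Data.List using (List; []; _∷_; map; _++_; filter; length; foldr; allFin)
open import Data.Bool.ListAction using (any; all)
open import Data.Vec using (Vec; []; _∷_; lookup; tabulate)
open import Data.Product using (Σ; _×_; _,_)
open import Function.Definitions using (Injective)
open import Relation.Binary.PropositionalEquality using (_≡_)
open import Relation.Nullary.Decidable using (isYes)
open import Data.Nat.Properties using (_<?_)
open import Relation.Unary using (Decidable)
import Data.Nat
import Data.Nat.Properties
import Data.Bool
import Data.Unit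
import Relation.Binary.PropositionalEquality

allSubsets : (n : ℕ) → List (Subset n)
allSubsets zero = [] ∷ []
allSubsets (suc n) = map (inside ∷_) (allSubsets n) ++ map (outside ∷_) (allSubsets n)

sumL : List ℕ → ℕ
sumL = foldr Data.Nat._+_ 0

countᵇ : {A : Set} → (A → Bool) → List A → ℕ
countᵇ p [] = 0
countᵇ p (x ∷ xs) = if p x then suc (countᵇ p xs) else countᵇ p xs

record Graph (N : ℕ) : Set where
  field
    adj   : Fin N → Fin N → Bool
    sym   : ∀ u v → adj u v ≡ adj v u
    irrefl : ∀ v → adj v v ≡ false
open Graph public

gdeg : ∀ {N} → Graph N → Fin N → ℕ
gdeg G v = countᵇ (adj G v) (allFin _)

maxDeg : ∀ {N} → Graph N → ℕ
maxDeg G = foldr _⊔_ 0 (map (gdeg G) (allFin _))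

eG : ∀ {N} → Graph N → ℕ
eG {N} G = sumL (map (λ u → countᵇ (λ v → isYes (toℕ u <? toℕ v) ∧ adj G u v) (allFin N)) (allFin N))

isCliqueᵇ : ∀ {N} → Graph N → Subset N → Bool
isCliqueᵇ {N} G S = all (λ u → all (λ v → inS u ∧' (inS v ∧' notEq u v) ⇒ adj G u v) (allFin N)) (allFin N)
  where
  inS : Fin N → Bool
  inS u = lookup S u
  _∧'_ : Bool → Bool → Bool
  _∧'_ = _∧_
  notEq : Fin N → Fin N → Bool
  notEq u v = if isYes (u ≟ v) then false else true
  _⇒_ : Bool → Bool → Bool
  true ⇒ b = b
  false ⇒ b = true
  infixr 5 _∧'_
  infixr 4 _⇒_

record Hypergraph (r n : ℕ) : Set where
  field
    edge    : Subset n → Bool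
    uniform : ∀ e → edge e ≡ true → ∣ e ∣ ≡ r
open Hypergraph public

hdeg : ∀ {r n} → Hypergraph r n → Fin n → ℕ
hdeg H v = countᵇ (λ e → edge H e ∧ lookup e v) (allSubsets _)

eH : ∀ {r n} → Hypergraph r n → ℕ
eH H = countᵇ (edge H) (allSubsets _)

Kr : ∀ {N} (r : ℕ) → Graph N → Hypergraph r N
Kr {N} r G = record { edge = λ S → (∣ S ∣ ≡ᵇ r) ∧ isCliqueᵇ G S ; uniform = pf }
  where
  pf : ∀ e → ((∣ e ∣ ≡ᵇ r) ∧ isCliqueᵇ G e) ≡ true → ∣ e ∣ ≡ r
  pf e h with ∣ e ∣ ≡ᵇ r in eq
  ... | true = Data.Nat.Properties.≡ᵇ⇒≡ ∣ e ∣ r (Relation.Binary.PropositionalEquality.subst Data.Bool.T (Relation.Binary.PropositionalEquality.sym eq) Data.Unit.tt)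
  pf e () | false

image : ∀ {n N} → (Fin n → Fin N) → Subset n → Subset N
image {n} φ e = tabulate (λ w → any (λ i → lookup e i ∧ isYes (φ i ≟ w)) (allFin n))

GraphEmbeds : ∀ {n N} → Graph n → Graph N → Set
GraphEmbeds {n} {N} F G = Σ (Fin n → Fin N) λ φ →
  Injective _≡_ _≡_ φ × (∀ u v → adj F u v ≡ true → adj G (φ u) (φ v) ≡ true)

GraphUniversal : ∀ {N} → (n D : ℕ) → Graph N → Set
GraphUniversal n D G = (F : Graph n) → (∀ v → gdeg F v ≤ D) → GraphEmbeds F G

HypEmbeds : ∀ {r n N} → Hypergraph r n → Hypergraph r N → Set
HypEmbeds {r} {n} {N} F H = Σ (Fin n → Fin N) λ φ →
  Injective _≡_ _≡_ φ × (∀ e → edge F e ≡ true → edge H (image φ e) ≡ true)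

-- the family F^(r)(n, D): r-uniform hypergraphs on n vertices with maximum degree ≤ D
HypUniversal : ∀ {r N} → (n D : ℕ) → Hypergraph r N → Set
HypUniversal {r} n D H = (F : Hypergraph r n) → (∀ v → hdeg F v ≤ D) → HypEmbeds F H

module Submission where

-- The shadow ∂F of an r-uniform hypergraph F joins two distinct vertices
-- lying in a common edge.  Each edge through v contributes at most r-1 shadow neighbours of
-- v, so ∂F has maximum degree at most (r-1)Δ and embeds injectively into G.  Such an
-- embedding maps every edge of F onto an r-set (injectivity) spanning a clique of G (all
-- pairs of the edge are shadow edges), i.e. onto an edge of K_r(G).
--
-- An (m+1)-clique inside a window W of a graph of maximum degree D either
-- avoids vertex 0 or consists of 0 ∈ W and an m-clique inside W ∩ N(0).  Induction on the
-- number of vertices bounds the (m+1)-cliques in W by |W|·D^m, and then the (m+2)-cliques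
-- of the whole graph by e·D^m (the cliques through 0 are counted in the window N(0)).

open import Defs hiding (sym)
open import Data.Nat using (ℕ; zero; suc; _+_; _*_; _^_; _∸_; _⊔_; _≤_; z≤n; s≤s; s<s; s<s⁻¹; _≡ᵇ_)
open import Data.Nat.Properties
  using (≤-refl; ≤-trans; ≤-reflexive; +-mono-≤; +-monoʳ-≤; *-monoˡ-≤; *-distribʳ-+; *-comm;
         +-suc; n≤1+n; m≤n⇒m≤1+n; m≤m⊔n; m≤n⊔m; _<?_; ≡⇒≡ᵇ; module ≤-Reasoning)
open import Data.Bool using (Bool; true; false; not; _∧_; _∨_; if_then_else_)
open import Data.Bool.Properties using (T-≡; ∧-comm; ∧-identityʳ; ∧-zeroʳ; ¬-not)
open import Data.Bool.ListAction using (or; all; any)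
open import Data.Fin using (Fin; zero; suc; toℕ; _≟_)
open import Data.Fin.Properties using (suc-injective)
open import Data.Fin.Subset using (Subset; ∣_∣; inside; outside)
open import Data.Vec using (_∷_; []; lookup)
open import Data.Vec.Properties using (lookup∘tabulate)
open import Data.List using (List; []; _∷_; _++_; map; foldr; tabulate; allFin)
open import Data.List.Properties using (map-tabulate; map-∘; map-cong)
import Data.List.Relation.Unary.All as All
import Data.List.Relation.Unary.Any as Any
open import Data.List.Relation.Unary.All.Properties using (all⁺)
open import Data.List.Relation.Unary.Any.Properties using (any⁺; any⁻)
open import Data.List.Membership.Propositional using (_∈_; lose)
open import Data.List.Membership.Propositional.Properties
  using (∈-allFin; ∈-map⁺; ∈-++⁺ˡ; ∈-++⁺ʳ)
open import Data.Product using (∃; _×_; _,_; proj₂)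
import Data.Product as Product
open import Data.Empty using (⊥; ⊥-elim)
open import Function using (_∘_; id; Injective; Equivalence; mk⇔)
open import Relation.Nullary using (yes; no; does; contradiction)
open import Relation.Nullary.Decidable using (isYes; isYes≗does; does-⇔; dec-true; dec-false; toWitness)
open import Relation.Binary.PropositionalEquality
  using (_≡_; _≢_; refl; sym; trans; cong; cong₂; module ≡-Reasoning)

open Equivalence using (to; from)

∧-true : ∀ a {b} → a ∧ b ≡ true → a ≡ true × b ≡ true
∧-true true {true} refl = refl , refl

module _ {A : Set} {p : A → Bool} where

  all-true⇒ : {xs : List A} {x : A} → all p xs ≡ true → x ∈ xs → p x ≡ true
  all-true⇒ {xs} h x∈xs = to T-≡ (All.lookup (all⁺ p xs (from T-≡ h)) x∈xs)

  all-false⇒ : (xs : List A) → all p xs ≡ false → ∃ λ x → p x ≡ false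
  all-false⇒ (x ∷ xs) h with p x in px
  ... | true  = all-false⇒ xs h
  ... | false = x , px

  any-true⇒ : (xs : List A) → any p xs ≡ true → ∃ λ x → p x ≡ true
  any-true⇒ xs h = Product.map₂ (to T-≡) (Any.satisfied (any⁻ p xs (from T-≡ h)))

  any-true⇐ : {xs : List A} {x : A} → x ∈ xs → p x ≡ true → any p xs ≡ true
  any-true⇐ x∈xs px = to T-≡ (any⁺ p (lose x∈xs (from T-≡ px)))

module _ {A : Set} where

  count-++ : (p : A → Bool) (xs ys : List A) → countᵇ p (xs ++ ys) ≡ countᵇ p xs + countᵇ p ys
  count-++ p []       ys = refl
  count-++ p (x ∷ xs) ys with p x
  ... | true  = cong suc (count-++ p xs ys)
  ... | false = count-++ p xs ys

  count-map : {B : Set} (p : A → Bool) (f : B → A) (xs : List B) →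
              countᵇ p (map f xs) ≡ countᵇ (p ∘ f) xs
  count-map p f []       = refl
  count-map p f (x ∷ xs) with p (f x)
  ... | true  = cong suc (count-map p f xs)
  ... | false = count-map p f xs

  count-cong : {p q : A → Bool} → (∀ x → p x ≡ q x) → (xs : List A) → countᵇ p xs ≡ countᵇ q xs
  count-cong h []                 = refl
  count-cong {q = q} h (x ∷ xs) rewrite h x with q x
  ... | true  = cong suc (count-cong h xs)
  ... | false = count-cong h xs

  count-false : {p : A → Bool} → (∀ x → p x ≡ false) → (xs : List A) → countᵇ p xs ≡ 0
  count-false h []                = refl
  count-false h (x ∷ xs) rewrite h x = count-false h xs

  count-mono : {p q : A → Bool} → (∀ x → p x ≡ true → q x ≡ true) → (xs : List A) →
               countᵇ p xs ≤ countᵇ q xs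
  count-mono h []                = z≤n
  count-mono {p} {q} h (x ∷ xs) with p x in px | q x in qx
  ... | true  | true  = s≤s (count-mono h xs)
  ... | true  | false = contradiction (trans (sym (h x px)) qx) λ ()
  ... | false | true  = m≤n⇒m≤1+n (count-mono h xs)
  ... | false | false = count-mono h xs

  count-∨ : (p q : A → Bool) (xs : List A) →
            countᵇ (λ x → p x ∨ q x) xs ≤ countᵇ p xs + countᵇ q xs
  count-∨ p q []       = z≤n
  count-∨ p q (x ∷ xs) with p x | q x
  ... | true  | true  = s≤s (≤-trans (count-∨ p q xs) (+-monoʳ-≤ (countᵇ p xs) (n≤1+n _)))
  ... | true  | false = s≤s (count-∨ p q xs)
  ... | false | true  = ≤-trans (s≤s (count-∨ p q xs)) (≤-reflexive (sym (+-suc _ _)))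
  ... | false | false = count-∨ p q xs

  sum-≤-count* : (f : A → ℕ) (p : A → Bool) (c : ℕ) → (∀ x → f x ≤ (if p x then c else 0)) →
                 (xs : List A) → sumL (map f xs) ≤ countᵇ p xs * c
  sum-≤-count* f p c h []       = z≤n
  sum-≤-count* f p c h (x ∷ xs) with p x | h x
  ... | true  | fx≤c = +-mono-≤ fx≤c (sum-≤-count* f p c h xs)
  ... | false | fx≤0 = ≤-trans (+-mono-≤ fx≤0 ≤-refl) (sum-≤-count* f p c h xs)

count-any-≤ : {A B : Set} (q : A → B → Bool) (xs : List A) (ys : List B) →
              countᵇ (λ y → any (λ x → q x y) xs) ys ≤ sumL (map (λ x → countᵇ (q x) ys) xs)
count-any-≤ q []       ys = ≤-reflexive (count-false (λ _ → refl) ys)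
count-any-≤ q (x ∷ xs) ys =
  ≤-trans (count-∨ (q x) (λ y → any (λ x → q x y) xs) ys) (+-mono-≤ ≤-refl (count-any-≤ q xs ys))

# : ∀ {n} → (Fin n → Bool) → ℕ
# {n} p = countᵇ p (allFin n)

-- Boolean inequality of elements of Fin n; it commutes with suc definitionally.
_≢ᵇ_ : ∀ {n} → Fin n → Fin n → Bool
i ≢ᵇ j = not (does (i ≟ j))

≢ᵇ-irrefl : ∀ {n} (i : Fin n) → (i ≢ᵇ i) ≡ false
≢ᵇ-irrefl i = cong not (dec-true (i ≟ i) refl)

≢ᵇ-true : ∀ {n} {i j : Fin n} → i ≢ j → (i ≢ᵇ j) ≡ true
≢ᵇ-true {i = i} {j} i≢j = cong not (dec-false (i ≟ j) i≢j)

≢ᵇ-sym : ∀ {n} (i j : Fin n) → (i ≢ᵇ j) ≡ (j ≢ᵇ i)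
≢ᵇ-sym i j = cong not (does-⇔ (mk⇔ sym sym) (i ≟ j) (j ≟ i))

allFin-suc : ∀ {n} → allFin (suc n) ≡ zero ∷ map suc (allFin n)
allFin-suc {n} = cong (zero ∷_) (sym (map-tabulate id suc))

any-allFin-suc : ∀ {n} (q : Fin (suc n) → Bool) →
                 any q (allFin (suc n)) ≡ q zero ∨ any (q ∘ suc) (allFin n)
any-allFin-suc {n} q = begin
  any q (allFin (suc n))                    ≡⟨ cong (any q) allFin-suc ⟩
  q zero ∨ any q (map suc (allFin n))       ≡⟨ cong (λ bs → q zero ∨ or bs) (sym (map-∘ (allFin n))) ⟩
  q zero ∨ any (q ∘ suc) (allFin n)         ∎
  where open ≡-Reasoning

#-suc : ∀ {n} (p : Fin (suc n) → Bool) → # p ≡ (if p zero then suc (# (p ∘ suc)) else # (p ∘ suc))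
#-suc {n} p = begin
  countᵇ p (allFin (suc n))              ≡⟨ cong (countᵇ p) allFin-suc ⟩
  countᵇ p (zero ∷ map suc (allFin n))   ≡⟨ cong (λ c → if p zero then suc c else c) (count-map p suc (allFin n)) ⟩
  (if p zero then suc (# (p ∘ suc)) else # (p ∘ suc)) ∎
  where open ≡-Reasoning

#-tail-≤ : ∀ {n} (p : Fin (suc n) → Bool) → # (p ∘ suc) ≤ # p
#-tail-≤ p rewrite #-suc p with p zero
... | true  = n≤1+n _
... | false = ≤-refl

#-remove : ∀ {n} (p : Fin n → Bool) (v : Fin n) → p v ≡ true → # p ≡ suc (# (λ j → p j ∧ (j ≢ᵇ v)))
#-remove {suc n} p zero pv rewrite #-suc p | #-suc (λ j → p j ∧ (j ≢ᵇ zero)) | pv =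
  cong suc (count-cong (λ j → sym (∧-identityʳ (p (suc j)))) (allFin n))
#-remove {suc n} p (suc v) pv
  rewrite #-suc p | #-suc (λ j → p j ∧ (j ≢ᵇ suc v)) | #-remove (p ∘ suc) v pv with p zero
... | true  = refl
... | false = refl

#-lookup : ∀ {n} (e : Subset n) → # (lookup e) ≡ ∣ e ∣
#-lookup []      = refl
#-lookup (x ∷ e) rewrite #-suc (lookup (x ∷ e)) with x
... | true  = cong suc (#-lookup e)
... | false = #-lookup e

IsClique : ∀ {N} → (Fin N → Fin N → Bool) → Subset N → Set
IsClique {N} A S = (u v : Fin N) → lookup S u ≡ true → lookup S v ≡ true → u ≢ v → A u v ≡ true

isClique⇒ : ∀ {N} (G : Graph N) (S : Subset N) → isCliqueᵇ G S ≡ true → IsClique (adj G) S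
isClique⇒ G S h u v su sv u≢v
  with lookup S u | lookup S v | u ≟ v | all-true⇒ (all-true⇒ h (∈-allFin u)) (∈-allFin v)
... | true  | true  | no _    | pairTest = pairTest
... | _     | _     | yes u≡v | _        = ⊥-elim (u≢v u≡v)

isClique⇐ : ∀ {N} (G : Graph N) (S : Subset N) → IsClique (adj G) S → isCliqueᵇ G S ≡ true
isClique⇐ {N} G S cl with isCliqueᵇ G S in test
... | true = refl
... | false with all-false⇒ (allFin N) test
... | u , rowFails with all-false⇒ (allFin N) rowFails
... | v , pairFails with lookup S u in su | lookup S v in sv | u ≟ v | pairFails
... | true  | true  | no u≢v | adjFails = contradiction (trans (sym (cl u v su sv u≢v)) adjFails) λ ()

tailRel : ∀ {N} → (Fin (suc N) → Fin (suc N) → Bool) → Fin N → Fin N → Bool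
tailRel A u v = A (suc u) (suc v)

IsClique-tail : ∀ {N} {A : Fin (suc N) → Fin (suc N) → Bool} {x : Bool} {S : Subset N} →
                IsClique A (x ∷ S) → IsClique (tailRel A) S
IsClique-tail cl u v su sv u≢v = cl (suc u) (suc v) su sv (u≢v ∘ suc-injective)

-- cliqueIn A W S tests that S spans an A-clique inside the window W by peeling off vertex 0:
-- when 0 ∈ S, the rest of S must be a clique inside W ∩ N(0).
cliqueIn : ∀ {N} → (Fin N → Fin N → Bool) → (Fin N → Bool) → Subset N → Bool
cliqueIn A W []             = true
cliqueIn A W (outside ∷ S) = cliqueIn (tailRel A) (W ∘ suc) S
cliqueIn A W (inside ∷ S)  = W zero ∧ cliqueIn (tailRel A) (λ v → W (suc v) ∧ A zero (suc v)) S

cliqueIn-intro : ∀ {N} (A : Fin N → Fin N → Bool) (W : Fin N → Bool) (S : Subset N) →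
                 (∀ u → lookup S u ≡ true → W u ≡ true) → IsClique A S → cliqueIn A W S ≡ true
cliqueIn-intro A W []             inW cl = refl
cliqueIn-intro A W (outside ∷ S) inW cl = cliqueIn-intro _ _ S (inW ∘ suc) (IsClique-tail cl)
cliqueIn-intro A W (inside ∷ S)  inW cl rewrite inW zero refl =
  cliqueIn-intro _ _ S (λ v sv → cong₂ _∧_ (inW (suc v) sv) (cl zero (suc v) refl sv λ ()))
                 (IsClique-tail cl)

∈-allSubsets : ∀ {n} (e : Subset n) → e ∈ allSubsets n
∈-allSubsets []            = Any.here refl
∈-allSubsets (inside ∷ e)  = ∈-++⁺ˡ (∈-map⁺ (inside ∷_) (∈-allSubsets e))
∈-allSubsets {suc n} (outside ∷ e) =
  ∈-++⁺ʳ (map (inside ∷_) (allSubsets n)) (∈-map⁺ (outside ∷_) (∈-allSubsets e))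

module _ {r n : ℕ} (F : Hypergraph r n) where

  shadowAdj : Fin n → Fin n → Bool
  shadowAdj u v = (u ≢ᵇ v) ∧ any (λ e → edge F e ∧ (lookup e u ∧ lookup e v)) (allSubsets n)

  shadow : Graph n
  shadow = record
    { adj    = shadowAdj
    ; sym    = λ u v → cong₂ _∧_ (≢ᵇ-sym u v)
                 (cong or
                   (map-cong (λ e → cong (edge F e ∧_) (∧-comm (lookup e u) (lookup e v))) (allSubsets n)))
    ; irrefl = shadowAdj-irrefl
    }
    where
    shadowAdj-irrefl : ∀ v → shadowAdj v v ≡ false
    shadowAdj-irrefl v rewrite ≢ᵇ-irrefl v = refl

  link : Fin n → Subset n → Fin n → Bool
  link v e j = (edge F e ∧ lookup e v) ∧ (lookup e j ∧ (j ≢ᵇ v))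

  shadowAdj⇒link : ∀ v j → shadowAdj v j ≡ true → any (λ e → link v e j) (allSubsets n) ≡ true
  shadowAdj⇒link v j h with ∧-true (v ≢ᵇ j) h
  ... | v≢j , common with any-true⇒ (allSubsets n) common
  ... | e , inEdge with ∧-true (edge F e) inEdge
  ... | ed , both with ∧-true (lookup e v) both
  ... | ev , ej = any-true⇐ (∈-allSubsets e)
        (cong₂ _∧_ (cong₂ _∧_ ed ev) (cong₂ _∧_ ej (trans (≢ᵇ-sym j v) v≢j)))

  link-size : ∀ v e → # (link v e) ≤ (if edge F e ∧ lookup e v then r ∸ 1 else 0)
  link-size v e with edge F e ∧ lookup e v in through
  ... | false = ≤-reflexive (count-false (λ _ → refl) (allFin n))
  ... | true  with ∧-true (edge F e) through
  ... | ed , ev = ≤-reflexive (cong (_∸ 1) (begin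
    suc (# (λ j → lookup e j ∧ (j ≢ᵇ v))) ≡⟨ sym (#-remove (lookup e) v ev) ⟩
    # (lookup e)                           ≡⟨ #-lookup e ⟩
    ∣ e ∣                                  ≡⟨ uniform F e ed ⟩
    r                                      ∎))
    where open ≡-Reasoning

  shadow-degree : (Δ : ℕ) → (∀ v → hdeg F v ≤ Δ) → ∀ v → gdeg shadow v ≤ (r ∸ 1) * Δ
  shadow-degree Δ hdeg≤Δ v = begin
    # (shadowAdj v)                                  ≤⟨ count-mono (shadowAdj⇒link v) (allFin n) ⟩
    # (λ j → any (λ e → link v e j) (allSubsets n))  ≤⟨ count-any-≤ (link v) (allSubsets n) (allFin n) ⟩
    sumL (map (λ e → # (link v e)) (allSubsets n))   ≤⟨ sum-≤-count* _ _ (r ∸ 1) (link-size v) (allSubsets n) ⟩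
    hdeg F v * (r ∸ 1)                               ≤⟨ *-monoˡ-≤ (r ∸ 1) (hdeg≤Δ v) ⟩
    Δ * (r ∸ 1)                                      ≡⟨ *-comm Δ (r ∸ 1) ⟩
    (r ∸ 1) * Δ                                      ∎
    where open ≤-Reasoning

hits : ∀ {n N} → (Fin n → Fin N) → (Fin n → Bool) → Fin N → Bool
hits {n} φ p w = any (λ i → p i ∧ isYes (φ i ≟ w)) (allFin n)

hits-member : ∀ {n N} (φ : Fin n → Fin N) (p : Fin n → Bool) (w : Fin N) →
              hits φ p w ≡ true → ∃ λ i → p i ≡ true × φ i ≡ w
hits-member {n} φ p w h with any-true⇒ (allFin n) h
... | i , hit with ∧-true (p i) hit
... | pi , φi≡w = i , pi , toWitness (from T-≡ φi≡w)

hits-avoid : ∀ {n N} (φ : Fin (suc n) → Fin N) (p : Fin (suc n) → Bool) → Injective _≡_ _≡_ φ →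
             hits (φ ∘ suc) (p ∘ suc) (φ zero) ≡ false
hits-avoid φ p inj = ¬-not λ h → suc≢zero (Product.proj₂ (hits-member (φ ∘ suc) (p ∘ suc) (φ zero) h))
  where
  suc≢zero : ∀ {i} → p (suc i) ≡ true × φ (suc i) ≡ φ zero → ⊥
  suc≢zero (_ , φi≡φ0) with inj φi≡φ0
  ... | ()

#-hits : ∀ {n N} (φ : Fin n → Fin N) (p : Fin n → Bool) → Injective _≡_ _≡_ φ → # (hits φ p) ≡ # p
#-hits {zero} {N} φ p inj = count-false (λ _ → refl) (allFin N)
#-hits {suc n} {N} φ p inj
  rewrite count-cong (λ w → any-allFin-suc (λ i → p i ∧ isYes (φ i ≟ w))) (allFin N) | #-suc p
  with p zero
... | false = #-hits (φ ∘ suc) (p ∘ suc) (suc-injective ∘ inj)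
... | true  = begin
  # (λ w → isYes (φ zero ≟ w) ∨ rest w)                          ≡⟨ #-remove _ (φ zero) φ0-hit ⟩
  suc (# (λ w → (isYes (φ zero ≟ w) ∨ rest w) ∧ (w ≢ᵇ φ zero))) ≡⟨ cong suc (count-cong drop-φ0 (allFin N)) ⟩
  suc (# rest)                                                   ≡⟨ cong suc (#-hits (φ ∘ suc) (p ∘ suc) (suc-injective ∘ inj)) ⟩
  suc (# (p ∘ suc))                                              ∎
  where
  open ≡-Reasoning
  rest : Fin N → Bool
  rest = hits (φ ∘ suc) (p ∘ suc)

  φ0-hit : (isYes (φ zero ≟ φ zero) ∨ rest (φ zero)) ≡ true
  φ0-hit with φ zero ≟ φ zero
  ... | yes _     = refl
  ... | no φ0≢φ0 = contradiction refl φ0≢φ0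

  -- away from φ 0 only the elements 1, 2, … are hit, and φ 0 itself is not hit by them
  drop-φ0 : ∀ w → ((isYes (φ zero ≟ w) ∨ rest w) ∧ (w ≢ᵇ φ zero)) ≡ rest w
  drop-φ0 w with φ zero ≟ w
  ... | yes refl = trans (≢ᵇ-irrefl (φ zero)) (sym (hits-avoid φ p inj))
  ... | no φ0≢w  = trans (cong (rest w ∧_) (≢ᵇ-true (φ0≢w ∘ sym))) (∧-identityʳ (rest w))

image-size : ∀ {n N} (φ : Fin n → Fin N) → Injective _≡_ _≡_ φ → (e : Subset n) → ∣ image φ e ∣ ≡ ∣ e ∣
image-size φ inj e = begin
  ∣ image φ e ∣           ≡⟨ sym (#-lookup (image φ e)) ⟩
  # (lookup (image φ e))  ≡⟨ count-cong (lookup∘tabulate (hits φ (lookup e))) (allFin _) ⟩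
  # (hits φ (lookup e))   ≡⟨ #-hits φ (lookup e) inj ⟩
  # (lookup e)            ≡⟨ #-lookup e ⟩
  ∣ e ∣                   ∎
  where open ≡-Reasoning

shadow-embedding⇒Kr : ∀ {r n N} (G : Graph N) (F : Hypergraph r n) →
                      GraphEmbeds (shadow F) G → HypEmbeds F (Kr r G)
shadow-embedding⇒Kr {r} G F (φ , inj , preserves) = φ , inj , edge↦clique
  where
  imageClique : ∀ e → edge F e ≡ true → IsClique (adj G) (image φ e)
  imageClique e ed u v su sv u≢v
    with hits-member φ (lookup e) u (trans (sym (lookup∘tabulate _ u)) su)
       | hits-member φ (lookup e) v (trans (sym (lookup∘tabulate _ v)) sv)
  ... | i , ei , refl | j , ej , refl =
    preserves i j (cong₂ _∧_ (≢ᵇ-true λ i≡j → u≢v (cong φ i≡j))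
                             (any-true⇐ (∈-allSubsets e) (cong₂ _∧_ ed (cong₂ _∧_ ei ej))))

  edge↦clique : ∀ e → edge F e ≡ true → edge (Kr r G) (image φ e) ≡ true
  edge↦clique e ed = cong₂ _∧_
    (to T-≡ (≡⇒≡ᵇ _ r (trans (image-size φ inj e) (uniform F e ed))))
    (isClique⇐ G (image φ e) (imageClique e ed))

-- First half of the lemma: the shadow of F is one of the graphs G is universal for.
Kr-universal : ∀ (Δ r n : ℕ) {N} (G : Graph N) →
               GraphUniversal n ((r ∸ 1) * Δ) G → HypUniversal n Δ (Kr r G)
Kr-universal Δ r n G universal F hdeg≤Δ =
  shadow-embedding⇒Kr G F (universal (shadow F) (shadow-degree F Δ hdeg≤Δ))

MaxDegree≤ : ∀ {N} → (Fin N → Fin N → Bool) → ℕ → Set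
MaxDegree≤ A D = ∀ u → # (A u) ≤ D

MaxDegree≤-tail : ∀ {N} {A : Fin (suc N) → Fin (suc N) → Bool} {D : ℕ} →
                  MaxDegree≤ A D → MaxDegree≤ (tailRel A) D
MaxDegree≤-tail {A = A} dg u = ≤-trans (#-tail-≤ (A (suc u))) (dg (suc u))

cliques : ∀ {N} → (Fin N → Fin N → Bool) → (Fin N → Bool) → ℕ → ℕ
cliques {N} A W m = countᵇ (λ S → (∣ S ∣ ≡ᵇ m) ∧ cliqueIn A W S) (allSubsets N)

count-allSubsets : ∀ {N} (p : Subset (suc N) → Bool) →
  countᵇ p (allSubsets (suc N)) ≡
    countᵇ (p ∘ (inside ∷_)) (allSubsets N) + countᵇ (p ∘ (outside ∷_)) (allSubsets N)
count-allSubsets {N} p =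
  trans (count-++ p (map (inside ∷_) (allSubsets N)) (map (outside ∷_) (allSubsets N)))
        (cong₂ _+_ (count-map p _ (allSubsets N)) (count-map p _ (allSubsets N)))

cliques-empty : ∀ {N} (A : Fin N → Fin N → Bool) (W : Fin N → Bool) → cliques A W 0 ≤ 1
cliques-empty {zero}  A W = ≤-refl
cliques-empty {suc N} A W
  rewrite count-allSubsets (λ S → (∣ S ∣ ≡ᵇ 0) ∧ cliqueIn A W S)
        | count-false (λ _ → refl) (allSubsets N) = cliques-empty (tailRel A) (W ∘ suc)

mutual
  cliques-window : ∀ {N} (A : Fin N → Fin N → Bool) (W : Fin N → Bool) (m D : ℕ) →
                   MaxDegree≤ A D → cliques A W (suc m) ≤ # W * D ^ m
  cliques-window {zero}  A W m D dg = z≤n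
  cliques-window {suc N} A W m D dg
    rewrite count-allSubsets (λ S → (∣ S ∣ ≡ᵇ suc m) ∧ cliqueIn A W S) | #-suc W
    with W zero
  ... | true  = +-mono-≤ (cliques-small-window (tailRel A) _ m D (MaxDegree≤-tail dg) neighbours≤D)
                         (cliques-window (tailRel A) (W ∘ suc) m D (MaxDegree≤-tail dg))
    where
    neighbours≤D : # (λ v → W (suc v) ∧ A zero (suc v)) ≤ D
    neighbours≤D = ≤-trans (count-mono (λ v → proj₂ ∘ ∧-true (W (suc v))) (allFin N))
                           (≤-trans (#-tail-≤ (A zero)) (dg zero))
  ... | false = ≤-trans (≤-reflexive (cong (_+ cliques (tailRel A) (W ∘ suc) (suc m)) noneThrough0))
                        (cliques-window (tailRel A) (W ∘ suc) m D (MaxDegree≤-tail dg))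
    where
    noneThrough0 : countᵇ (λ S → (∣ S ∣ ≡ᵇ m) ∧ false) (allSubsets N) ≡ 0
    noneThrough0 = count-false (λ S → ∧-zeroʳ (∣ S ∣ ≡ᵇ m)) (allSubsets N)

  cliques-small-window : ∀ {N} (A : Fin N → Fin N → Bool) (W : Fin N → Bool) (m D : ℕ) →
                         MaxDegree≤ A D → # W ≤ D → cliques A W m ≤ D ^ m
  cliques-small-window A W zero    D dg W≤D = cliques-empty A W
  cliques-small-window A W (suc m) D dg W≤D =
    ≤-trans (cliques-window A W m D dg) (*-monoˡ-≤ (D ^ m) W≤D)

edges : ∀ {N} → (Fin N → Fin N → Bool) → ℕ
edges {N} A = sumL (map (λ u → # (λ v → isYes (toℕ u <? toℕ v) ∧ A u v)) (allFin N))

<?-suc : (a b : ℕ) → isYes (suc a <? suc b) ≡ isYes (a <? b)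
<?-suc a b = begin
  isYes (suc a <? suc b) ≡⟨ isYes≗does _ ⟩
  does (suc a <? suc b)  ≡⟨ does-⇔ (mk⇔ s<s⁻¹ s<s) (suc a <? suc b) (a <? b) ⟩
  does (a <? b)          ≡⟨ sym (isYes≗does _) ⟩
  isYes (a <? b)         ∎
  where open ≡-Reasoning

edges-suc : ∀ {N} (A : Fin (suc N) → Fin (suc N) → Bool) → edges A ≡ # (A zero ∘ suc) + edges (tailRel A)
edges-suc {N} A = cong₂ _+_ (#-suc (λ v → isYes (0 <? toℕ v) ∧ A zero v)) (begin
  sumL (map up (tabulate suc))           ≡⟨ cong (sumL ∘ map up) (sym (map-tabulate id suc)) ⟩
  sumL (map up (map suc (allFin N)))     ≡⟨ cong sumL (sym (map-∘ (allFin N))) ⟩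
  sumL (map (up ∘ suc) (allFin N))       ≡⟨ cong sumL (map-cong shift (allFin N)) ⟩
  edges (tailRel A)                      ∎)
  where
  open ≡-Reasoning
  up : Fin (suc N) → ℕ
  up u = # (λ v → isYes (toℕ u <? toℕ v) ∧ A u v)
  shift : ∀ u → up (suc u) ≡ # (λ v → isYes (toℕ u <? toℕ v) ∧ tailRel A u v)
  shift u = trans (#-suc (λ v → isYes (toℕ (suc u) <? toℕ v) ∧ A (suc u) v))
                  (count-cong (λ v → cong (_∧ A (suc u) (suc v)) (<?-suc (toℕ u) (toℕ v))) (allFin N))

-- A graph of maximum degree D with e edges has at most e·D^m cliques with m+2 vertices:
-- the cliques through vertex 0 are (m+1)-cliques inside its neighbourhood.
cliques-edges : ∀ {N} (A : Fin N → Fin N → Bool) (m D : ℕ) → MaxDegree≤ A D →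
                cliques A (λ _ → true) (suc (suc m)) ≤ edges A * D ^ m
cliques-edges {zero}  A m D dg = z≤n
cliques-edges {suc N} A m D dg
  rewrite count-allSubsets (λ S → (∣ S ∣ ≡ᵇ suc (suc m)) ∧ cliqueIn A (λ _ → true) S)
        | edges-suc A | *-distribʳ-+ (D ^ m) (# (A zero ∘ suc)) (edges (tailRel A)) =
  +-mono-≤ (cliques-window (tailRel A) (A zero ∘ suc) m D (MaxDegree≤-tail dg))
           (cliques-edges (tailRel A) m D (MaxDegree≤-tail dg))

degree≤maxDeg : ∀ {N} (G : Graph N) → MaxDegree≤ (adj G) (maxDeg G)
degree≤maxDeg G u = foldr-⊔ (∈-map⁺ (gdeg G) (∈-allFin u))
  where
  foldr-⊔ : ∀ {x} {xs : List ℕ} → x ∈ xs → x ≤ foldr _⊔_ 0 xs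
  foldr-⊔ {xs = y ∷ _}  (Any.here refl) = m≤m⊔n y _
  foldr-⊔ {xs = y ∷ _}  (Any.there x∈)  = ≤-trans (foldr-⊔ x∈) (m≤n⊔m y _)

Kr-edges : ∀ {N} (m : ℕ) (G : Graph N) → eH (Kr (suc (suc m)) G) ≤ eG G * maxDeg G ^ m
Kr-edges {N} m G = ≤-trans
  (count-mono (λ S h → let size , clique = ∧-true (∣ S ∣ ≡ᵇ suc (suc m)) h in
                        cong₂ _∧_ size (cliqueIn-intro (adj G) _ S (λ _ _ → refl) (isClique⇒ G S clique)))
              (allSubsets N))
  (cliques-edges (adj G) m (maxDeg G) (degree≤maxDeg G))

-- Lemma 5.3: for r = m + 2 (the hypothesis r ≥ 3 excludes r = 1) the two halves combine.
lemma5p3 : (Δ r : ℕ) → 1 ≤ Δ → 3 ≤ r → (n N : ℕ) → (G : Graph N) →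
    GraphUniversal n ((r ∸ 1) * Δ) G →
    HypUniversal n Δ (Kr r G) × eH (Kr r G) ≤ eG G * maxDeg G ^ (r ∸ 2)
lemma5p3 Δ 1             _ (s≤s ())       n N G _
lemma5p3 Δ (suc (suc m)) _ _                n N G universal =
  Kr-universal Δ (suc (suc m)) n G universal , Kr-edges m G
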